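{- Let $\pi=\pi_1\pi_2\cdots\pi_n\in S_n$. Then $q^{ -1}(\pi)\neq\emptyset$ if and only if $\pi_n=n$.
   Context: $S_n$ is the set of permutations of $\{1,\dots,n\}$ in one-line notation. An entry $\pi_i$ is a left-to-right (LTR) maximum if $\pi_i>\pi_j$ for all $j<i$. The map $q:S_n\to S_n$ (the algorithm Queuesort, sorting with a queue allowing bypass): let $m_1,\dots,m_r$ be the LTR maxima of $\pi$ from left to right; for $i=r,\dots,1$ in this order, repeatedly swap $m_i$ with the entry immediately to its right as long as such an entry exists and is smaller than $m_i$; the result is $q(\pi)$. $q^{ -1}(\pi)=\{\sigma\in S_n: q(\sigma)=\pi\}$. -}

module Defs where

open import Data.Nat using (ℕ; _<ᵇ_; _≡ᵇ_)
open import Data.Bool using (if_then_else_)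
open import Data.List using (List; []; _∷_; foldr; map; tabulate)
open import Data.Fin using (Fin; toℕ)
open import Data.Fin.Permutation using (Permutation′; _⟨$⟩ʳ_)

-- Values are 0-based (Fin n), i.e. value k stands for k+1; this is an
-- order-preserving relabelling and does not affect Queuesort.
oneLine : ∀ {n} → Permutation′ n → List ℕ
oneLine {n} π = map toℕ (tabulate (λ i → π ⟨$⟩ʳ i))

ltrAbove : ℕ → List ℕ → List ℕ
ltrAbove m [] = []
ltrAbove m (y ∷ ys) = if m <ᵇ y then y ∷ ltrAbove y ys else ltrAbove m ys

ltrMaxima : List ℕ → List ℕ
ltrMaxima [] = []
ltrMaxima (x ∷ xs) = x ∷ ltrAbove x xs

push : ℕ → List ℕ → List ℕ
push m [] = m ∷ []
push m (y ∷ ys) = if y <ᵇ m then y ∷ push m ys else m ∷ y ∷ ys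

bubble : ℕ → List ℕ → List ℕ
bubble m [] = []
bubble m (x ∷ xs) = if x ≡ᵇ m then push m xs else x ∷ bubble m xs

-- Queuesort: with LTR maxima m_1..m_r, process m_r first, then m_{r-1}, ..., m_1.
-- foldr bubble w [m_1,...,m_r] = bubble m_1 (... (bubble m_r w)).
queuesort : List ℕ → List ℕ
queuesort w = foldr bubble w (ltrMaxima w)

-- The largest value n is the last left-to-right maximum, so Queuesort moves it
-- first, all the way to the end of the word. Every later move pushes a smaller
-- LTR maximum to the right, and such an entry stops in front of n; hence n
-- stays last. Conversely, if π ends with n, then n is the only LTR maximum of
-- the word n π₁ ⋯ πₙ₋₁, and Queuesort moves it to the end, producing π.
module Submission where

open import Defs
open import Data.Bool using (true; false)
open import Data.Empty using (⊥-elim)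
open import Data.Fin as Fin using (Fin; fromℕ; inject₁; lower₁; toℕ)
open import Data.Fin.Permutation
  using (Permutation′; permutation; _⟨$⟩ʳ_; _⟨$⟩ˡ_; _∘ₚ_; inverseˡ; inverseʳ)
open import Data.Fin.Properties
  using (toℕ-injective; toℕ-fromℕ; toℕ≤pred[n]; fromℕ≢inject₁; toℕ-inject₁-≢;
         inject₁-lower₁; lower₁-inject₁′; suc-injective)
open import Data.List using (List; []; _∷_; _++_; _∷ʳ_; [_]; foldr; tabulate)
open import Data.List.Properties using (foldr-++; map-tabulate)
open import Data.List.Relation.Unary.All as All using (All; []; _∷_)
open import Data.List.Relation.Unary.All.Properties using (tabulate⁺; ++⁺)
open import Data.Nat using (ℕ; zero; suc; _<_; _≤_; _<ᵇ_; _≡ᵇ_; _≟_)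
open import Data.Nat.Properties
  using (<ᵇ-reflects-<; <⇒≤; <⇒≢; ≤⇒≯; ≤∧≢⇒<)
open import Data.Product using (∃; ∃₂; _×_; _,_)
open import Function using (_∘_)
open import Function.Bundles using (_⇔_; mk⇔)
open import Relation.Binary.PropositionalEquality
  using (_≡_; _≢_; refl; sym; trans; cong; subst; module ≡-Reasoning)
open import Relation.Nullary using (Dec; yes; no)
open import Relation.Nullary.Reflects using (Reflects; ofʸ; ofⁿ; det)

private
  variable
    m n M : ℕ
    w as bs : List ℕ

≡ᵇ-reflects-≡ : ∀ m n → Reflects (m ≡ n) (m ≡ᵇ n)
≡ᵇ-reflects-≡ m n = Dec.proof (m ≟ n)

<ᵇ-true : m < n → (m <ᵇ n) ≡ true
<ᵇ-true {m} {n} m<n = det (<ᵇ-reflects-< m n) (ofʸ m<n)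

<ᵇ-false : n ≤ m → (m <ᵇ n) ≡ false
<ᵇ-false {n} {m} n≤m = det (<ᵇ-reflects-< m n) (ofⁿ (≤⇒≯ n≤m))

≡ᵇ-refl : ∀ m → (m ≡ᵇ m) ≡ true
≡ᵇ-refl m = det (≡ᵇ-reflects-≡ m m) (ofʸ refl)

≡ᵇ-false : m ≢ n → (m ≡ᵇ n) ≡ false
≡ᵇ-false {m} {n} m≢n = det (≡ᵇ-reflects-≡ m n) (ofⁿ m≢n)

data MaxLast (M : ℕ) : List ℕ → Set where
  last : MaxLast M [ M ]
  _∷_  : ∀ {y w} → y < M → MaxLast M w → MaxLast M (y ∷ w)

MaxLast-∷ʳ : All (_< M) w → MaxLast M (w ∷ʳ M)
MaxLast-∷ʳ []         = last
MaxLast-∷ʳ (y<M ∷ ys) = y<M ∷ MaxLast-∷ʳ ys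

MaxLast-last : ∀ {x} w → MaxLast M (w ∷ʳ x) → x ≡ M
MaxLast-last []          last         = refl
MaxLast-last (_ ∷ [])    (_ ∷ last)   = refl
MaxLast-last (_ ∷ y ∷ w) (_ ∷ max)    = MaxLast-last (y ∷ w) max

push-MaxLast : m < M → MaxLast M w → MaxLast M (push m w)
push-MaxLast {m} {M} m<M last rewrite <ᵇ-false (<⇒≤ m<M) = m<M ∷ last
push-MaxLast {m} m<M (_∷_ {y} y<M max) with y <ᵇ m
... | true  = y<M ∷ push-MaxLast m<M max
... | false = m<M ∷ y<M ∷ max

bubble-MaxLast : MaxLast M w → MaxLast M (bubble m w)
bubble-MaxLast {M} {m = m} last with M ≡ᵇ m | ≡ᵇ-reflects-≡ M m
... | true  | ofʸ refl = last
... | false | _        = last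
bubble-MaxLast {m = m} (_∷_ {y} y<M max) with y ≡ᵇ m | ≡ᵇ-reflects-≡ y m
... | true  | ofʸ refl = push-MaxLast y<M max
... | false | _        = y<M ∷ bubble-MaxLast max

foldr-bubble-MaxLast : ∀ ms → MaxLast M w → MaxLast M (foldr bubble w ms)
foldr-bubble-MaxLast []       max = max
foldr-bubble-MaxLast (m ∷ ms) max = bubble-MaxLast (foldr-bubble-MaxLast ms max)

push-below : All (_< m) w → push m w ≡ w ∷ʳ m
push-below []                     = refl
push-below {w = y ∷ _} (y<m ∷ ys) rewrite <ᵇ-true y<m = cong (y ∷_) (push-below ys)

bubble-max : All (_< n) as → All (_< n) bs → bubble n (as ++ n ∷ bs) ≡ (as ++ bs) ∷ʳ n
bubble-max {n} [] bs rewrite ≡ᵇ-refl n = push-below bs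
bubble-max {as = x ∷ _} (x<n ∷ as) bs rewrite ≡ᵇ-false (<⇒≢ x<n) =
  cong (x ∷_) (bubble-max as bs)

ltrAbove-≤ : All (_≤ m) w → ltrAbove m w ≡ []
ltrAbove-≤ []                       = refl
ltrAbove-≤ {w = y ∷ _} (y≤m ∷ ys) rewrite <ᵇ-false y≤m = ltrAbove-≤ ys

ltrAbove-max : m < n → All (_< n) as → All (_< n) bs →
  ltrAbove m (as ++ n ∷ bs) ≡ ltrAbove m as ∷ʳ n
ltrAbove-max m<n [] bs rewrite <ᵇ-true m<n | ltrAbove-≤ (All.map <⇒≤ bs) = refl
ltrAbove-max {m} {as = x ∷ _} m<n (x<n ∷ as) bs with m <ᵇ x
... | true  = cong (x ∷_) (ltrAbove-max x<n as bs)
... | false = ltrAbove-max m<n as bs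

ltrMaxima-max : All (_< n) as → All (_< n) bs →
  ltrMaxima (as ++ n ∷ bs) ≡ ltrMaxima as ∷ʳ n
ltrMaxima-max [] bs rewrite ltrAbove-≤ (All.map <⇒≤ bs) = refl
ltrMaxima-max {as = x ∷ _} (x<n ∷ as) bs = cong (x ∷_) (ltrAbove-max x<n as bs)

queuesort-max : All (_< n) as → All (_< n) bs →
  queuesort (as ++ n ∷ bs) ≡ foldr bubble ((as ++ bs) ∷ʳ n) (ltrMaxima as)
queuesort-max {n} {as} {bs} as<n bs<n = begin
  foldr bubble word (ltrMaxima word)             ≡⟨ cong (foldr bubble word) (ltrMaxima-max as<n bs<n) ⟩
  foldr bubble word (ltrMaxima as ∷ʳ n)          ≡⟨ foldr-++ bubble word (ltrMaxima as) [ n ] ⟩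
  foldr bubble (bubble n word) (ltrMaxima as)    ≡⟨ cong (λ v → foldr bubble v (ltrMaxima as)) (bubble-max as<n bs<n) ⟩
  foldr bubble ((as ++ bs) ∷ʳ n) (ltrMaxima as)  ∎
  where
  open ≡-Reasoning
  word : List ℕ
  word = as ++ n ∷ bs

queuesort-MaxLast : All (_< n) as → All (_< n) bs → MaxLast n (queuesort (as ++ n ∷ bs))
queuesort-MaxLast {n} {as} as<n bs<n =
  subst (MaxLast n) (sym (queuesort-max as<n bs<n))
    (foldr-bubble-MaxLast (ltrMaxima as) (MaxLast-∷ʳ (++⁺ as<n bs<n)))

queuesort-max∷ : All (_< n) w → queuesort (n ∷ w) ≡ w ∷ʳ n
queuesort-max∷ = queuesort-max []

tabulate-∷ʳ : ∀ {A : Set} {m} (g : Fin (suc m) → A) →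
  tabulate g ≡ tabulate (g ∘ inject₁) ∷ʳ g (fromℕ m)
tabulate-∷ʳ {m = zero}  g = refl
tabulate-∷ʳ {m = suc m} g = cong (g Fin.zero ∷_) (tabulate-∷ʳ (g ∘ Fin.suc))

tabulate-split : ∀ {A : Set} {P : A → Set} {m x} (g : Fin m → A) (k : Fin m) →
  g k ≡ x → (∀ i → i ≢ k → P (g i)) →
  ∃₂ λ as bs → tabulate g ≡ as ++ x ∷ bs × All P as × All P bs
tabulate-split g Fin.zero refl P-g =
  [] , tabulate (g ∘ Fin.suc) , refl , [] , tabulate⁺ (λ i → P-g (Fin.suc i) λ ())
tabulate-split g (Fin.suc k) gk≡x P-g
  with as , bs , eq , P-as , P-bs ←
       tabulate-split (g ∘ Fin.suc) k gk≡x (λ i i≢k → P-g (Fin.suc i) (i≢k ∘ suc-injective))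
  = g Fin.zero ∷ as , bs , cong (g Fin.zero ∷_) eq , P-g Fin.zero (λ ()) ∷ P-as , P-bs

toℕ<n : ∀ {i : Fin (suc n)} → i ≢ fromℕ n → toℕ i < n
toℕ<n {n} {i} i≢n =
  ≤∧≢⇒< (toℕ≤pred[n] i) (λ i≡n → i≢n (toℕ-injective (trans i≡n (sym (toℕ-fromℕ n)))))

toℕ-permute-< : ∀ (π : Permutation′ (suc n)) {i} → i ≢ π ⟨$⟩ˡ fromℕ n → toℕ (π ⟨$⟩ʳ i) < n
toℕ-permute-< {n} π {i} i≢k = toℕ<n λ πi≡n →
  i≢k (trans (sym (inverseˡ π)) (cong (π ⟨$⟩ˡ_) πi≡n))

oneLine-split : (σ : Permutation′ (suc n)) →
  ∃₂ λ as bs → oneLine σ ≡ as ++ n ∷ bs × All (_< n) as × All (_< n) bs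
oneLine-split {n} σ
  with as , bs , eq , as<n , bs<n ←
       tabulate-split (toℕ ∘ (σ ⟨$⟩ʳ_)) (σ ⟨$⟩ˡ fromℕ n)
         (trans (cong toℕ (inverseʳ σ)) (toℕ-fromℕ n)) (λ _ → toℕ-permute-< σ)
  = as , bs , trans (map-tabulate (σ ⟨$⟩ʳ_) toℕ) eq , as<n , bs<n

oneLine-∷ʳ : (π : Permutation′ (suc n)) →
  oneLine π ≡ tabulate (toℕ ∘ (π ⟨$⟩ʳ_) ∘ inject₁) ∷ʳ toℕ (π ⟨$⟩ʳ fromℕ n)
oneLine-∷ʳ π = trans (map-tabulate (π ⟨$⟩ʳ_) toℕ) (tabulate-∷ʳ (toℕ ∘ (π ⟨$⟩ʳ_)))

rotate : Fin (suc n) → Fin (suc n)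
rotate Fin.zero    = fromℕ _
rotate (Fin.suc i) = inject₁ i

unrotate : Fin (suc n) → Fin (suc n)
unrotate {n} j with n ≟ toℕ j
... | yes _   = Fin.zero
... | no n≢j = Fin.suc (lower₁ j n≢j)

rotate-unrotate : ∀ (j : Fin (suc n)) → rotate (unrotate j) ≡ j
rotate-unrotate {n} j with n ≟ toℕ j
... | yes n≡j = toℕ-injective (trans (toℕ-fromℕ n) n≡j)
... | no n≢j  = inject₁-lower₁ j n≢j

unrotate-rotate : ∀ (i : Fin (suc n)) → unrotate (rotate i) ≡ i
unrotate-rotate {n} Fin.zero with n ≟ toℕ (fromℕ n)
... | yes _   = refl
... | no n≢n = ⊥-elim (n≢n (sym (toℕ-fromℕ n)))
unrotate-rotate {n} (Fin.suc i) with n ≟ toℕ (inject₁ i)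
... | yes n≡i = ⊥-elim (toℕ-inject₁-≢ i n≡i)
... | no n≢i  = cong Fin.suc (lower₁-inject₁′ i n≢i)

rotation : Permutation′ (suc n)
rotation = permutation rotate unrotate rotate-unrotate unrotate-rotate

oneLine-rotation : (π : Permutation′ (suc n)) →
  oneLine (rotation ∘ₚ π) ≡ toℕ (π ⟨$⟩ʳ fromℕ n) ∷ tabulate (toℕ ∘ (π ⟨$⟩ʳ_) ∘ inject₁)
oneLine-rotation π = map-tabulate ((rotation ∘ₚ π) ⟨$⟩ʳ_) toℕ

queuesort-oneLine-MaxLast : (σ : Permutation′ (suc n)) → MaxLast n (queuesort (oneLine σ))
queuesort-oneLine-MaxLast {n} σ with as , bs , σ≡ , as<n , bs<n ← oneLine-split σ =
  subst (MaxLast n ∘ queuesort) (sym σ≡) (queuesort-MaxLast as<n bs<n)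

oneLine-MaxLast : (π : Permutation′ (suc n)) → MaxLast n (oneLine π) → π ⟨$⟩ʳ fromℕ n ≡ fromℕ n
oneLine-MaxLast {n} π max = toℕ-injective (begin
  toℕ (π ⟨$⟩ʳ fromℕ n)  ≡⟨ MaxLast-last _ (subst (MaxLast n) (oneLine-∷ʳ π) max) ⟩
  n                     ≡⟨ toℕ-fromℕ n ⟨
  toℕ (fromℕ n)         ∎)
  where open ≡-Reasoning

queuesort-rotation : (π : Permutation′ (suc n)) → π ⟨$⟩ʳ fromℕ n ≡ fromℕ n →
  queuesort (oneLine (rotation ∘ₚ π)) ≡ oneLine π
queuesort-rotation {n} π πn≡n = begin
  queuesort (oneLine (rotation ∘ₚ π))      ≡⟨ cong queuesort (oneLine-rotation π) ⟩
  queuesort (toℕ (π ⟨$⟩ʳ fromℕ n) ∷ init)  ≡⟨ cong (λ v → queuesort (v ∷ init)) last≡n ⟩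
  queuesort (n ∷ init)                     ≡⟨ queuesort-max∷ (tabulate⁺ (toℕ-permute-< π ∘ inject₁≢)) ⟩
  init ∷ʳ n                                ≡⟨ cong (init ∷ʳ_) last≡n ⟨
  init ∷ʳ toℕ (π ⟨$⟩ʳ fromℕ n)             ≡⟨ oneLine-∷ʳ π ⟨
  oneLine π                                ∎
  where
  open ≡-Reasoning
  init : List ℕ
  init = tabulate (toℕ ∘ (π ⟨$⟩ʳ_) ∘ inject₁)
  last≡n : toℕ (π ⟨$⟩ʳ fromℕ n) ≡ n
  last≡n = trans (cong toℕ πn≡n) (toℕ-fromℕ n)
  inject₁≢ : ∀ i → inject₁ i ≢ π ⟨$⟩ˡ fromℕ n
  inject₁≢ i e = fromℕ≢inject₁ (sym (trans e (trans (cong (π ⟨$⟩ˡ_) (sym πn≡n)) (inverseˡ π))))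

proposition2p1 : (n : ℕ) (π : Permutation′ (suc n)) →
    (∃ λ (σ : Permutation′ (suc n)) → queuesort (oneLine σ) ≡ oneLine π)
      ⇔ (π ⟨$⟩ʳ fromℕ n ≡ fromℕ n)
proposition2p1 n π = mk⇔
  (λ (σ , qσ≡π) → oneLine-MaxLast π (subst (MaxLast n) qσ≡π (queuesort-oneLine-MaxLast σ)))
  (λ πn≡n → rotation ∘ₚ π , queuesort-rotation π πn≡n)
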